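{- Let $P$ be a primitive Dyck path containing $DUU$, with skeleton $S$, body $B$ and position $pos$. Then $F(P)$ is the primitive Dyck path containing $DUU$ whose skeleton is $F(S)$, whose body is $F(B)$, and whose position is $pos$ if the height of $S$ is odd and the opposite position $pos'$ if the height of $S$ is even.
   Context: Dyck paths are words in $U$ (upstep) and $D$ (downstep) with equally many of each such that every prefix has at least as many $U$'s as $D$'s; size = number of $U$'s; $\epsilon$ = empty path; powers denote repetition; a subpath is a block of consecutive steps. A nonempty Dyck path is primitive if no nonempty proper prefix is a Dyck path; every nonempty Dyck path is uniquely a concatenation of primitive ones (its components). The height of a vertex is its height above the starting level; the height of a path is its maximal vertex height. The matching downstep of an upstep $u$ is the last step of the shortest Dyck subpath starting with $u$. The bijection $F$ on Dyck paths: $F(\epsilon)=\epsilon$; if $P$ has components $P_1,\dots,P_r$, $r\ge2$, then $F(P)=F(P_1)\cdots F(P_r)$; a primitive $P$ is uniquely $P=UQ(UD)^iD$ with $i\ge0$ and $Q$ a Dyck path that is empty or ends with $DD$, and $F(P)=U^{i+1}F(R)UDD^{i+1}$ if $Q$ is primitive, $Q=URD$, while $F(P)=U^{i+1}F(Q)D^{i+1}$ if $Q$ is not primitive (including $Q=\epsilon$). Skeleton/body decomposition: let $P$ be primitive and contain a subpath $DUU$; the height of an occurrence of $DUU$ is the height of the vertex between its $D$ and its first $U$. Let $h$ be the minimum such height and take the rightmost occurrence of height $h$. Write $P=AQB$ where $A=U^h$ is the first $h$ steps, $Q$ runs from step $h+1$ through the matching downstep of the middle $U$ of that occurrence, and $B$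 is the rest. Then the skeleton $S=AB$ is a primitive $DUU$-avoiding Dyck path, and the body $Q$ is a nonempty, non-primitive Dyck path ending with $DD$. The first peak upstep of $S$ is the first $U$ of $S$ immediately followed by $D$; $P$ is recovered from $S$ by inserting $Q$ either immediately before that upstep (position $bot$) or immediately after it (position $top$), and $P$ has position $top$ or $bot$ accordingly (when $S=UD$ the position is necessarily $top$). This gives a bijection between primitive Dyck paths containing $DUU$ and triples $(S,Q,pos)$ with $S$ primitive $DUU$-avoiding, $Q$ nonempty non-primitive ending in $DD$, $pos\in\{top,bot\}$, and $pos=top$ if $S=UD$. $pos'$ denotes the position other than $pos$. -}

module Defs where

open import Data.Nat using (ℕ; zero; suc; _∸_; _⊔_; _≤_; _<_)
open import Data.List using (List; []; _∷_; _++_; take; drop; length; reverse; replicate)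
open import Data.Maybe using (Maybe; just; nothing)
open import Data.Product using (_×_; _,_; ∃; Σ; map₁)
open import Relation.Binary.PropositionalEquality using (_≡_; _≢_)
open import Relation.Nullary using (¬_)

data Step : Set where
  U D : Step

Path : Set
Path = List Step

walk : ℕ → Path → Maybe ℕ
walk h []            = just h
walk h (U ∷ w)       = walk (suc h) w
walk zero (D ∷ w)    = nothing
walk (suc h) (D ∷ w) = walk h w

-- Dyck path: every prefix has at least as many U as D, and equally many overall.
IsDyck : Path → Set
IsDyck w = walk 0 w ≡ just 0

Primitive : Path → Set
Primitive P = IsDyck P × P ≢ [] ×
  (∀ k → 0 < k → k < length P → ¬ IsDyck (take k P))

countU countD : Path → ℕ
countU []      = 0
countU (U ∷ w) = suc (countU w)
countU (D ∷ w) = countU w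
countD []      = 0
countD (U ∷ w) = countD w
countD (D ∷ w) = suc (countD w)

level : Path → ℕ
level w = countU w ∸ countD w

hgo : ℕ → Path → ℕ
hgo h []      = h
hgo h (U ∷ w) = h ⊔ hgo (suc h) w
hgo h (D ∷ w) = h ⊔ hgo (h ∸ 1) w

height : Path → ℕ
height = hgo 0

-- spl h w: split off the prefix of w that first returns to level 0,
-- starting from height h.
spl : ℕ → Path → Path × Path
spl h []                   = [] , []
spl h (U ∷ w)              = map₁ (U ∷_) (spl (suc h) w)
spl zero (D ∷ w)           = [] , D ∷ w
spl (suc zero) (D ∷ w)     = D ∷ [] , w
spl (suc (suc h)) (D ∷ w)  = map₁ (D ∷_) (spl (suc h) w)

firstComp : Path → Path × Path
firstComp = spl 0

middle : Path → Path
middle w = reverse (drop 1 (reverse (drop 1 w)))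

-- on a reversed word: strip maximal leading (D U)* (i.e. trailing (U D)^i)
stripRev : Path → ℕ × Path
stripRev (D ∷ U ∷ r) = map₁ suc (stripRev r)
stripRev r           = 0 , r

-- F with fuel (fuel = length of input suffices, every recursive call is
-- on a strictly shorter word).
mutual
  F' : ℕ → Path → Path
  F' zero w          = []
  F' (suc n) []      = []
  F' (suc n) (x ∷ w) with firstComp (x ∷ w)
  ... | c , []      = Fprim n c
  ... | c , (y ∷ r) = F' n c ++ F' n (y ∷ r)

  -- primitive case: P = U Q (UD)^i D
  Fprim : ℕ → Path → Path
  Fprim n P with stripRev (reverse (middle P))
  ... | i , rQ = Fcase n i (reverse rQ)

  Fcase : ℕ → ℕ → Path → Path
  Fcase n i []      = replicate (suc i) U ++ replicate (suc i) D
  Fcase n i (x ∷ q) with firstComp (x ∷ q)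
  -- Q primitive, Q = U R D
  ... | c , []      = replicate (suc i) U ++ F' n (middle (x ∷ q)) ++ (U ∷ D ∷ replicate (suc i) D)
  -- Q not primitive
  ... | c , (y ∷ r) = replicate (suc i) U ++ F' n (x ∷ q) ++ replicate (suc i) D

F : Path → Path
F w = F' (length w) w

-- step i (0-indexed) starts an occurrence of DUU
DUUat : Path → ℕ → Set
DUUat P i = ∃ λ r → drop i P ≡ D ∷ U ∷ U ∷ r

ContainsDUU : Path → Set
ContainsDUU P = ∃ λ i → DUUat P i

-- subpath from step k through step m (0-indexed, inclusive)
slice : Path → ℕ → ℕ → Path
slice P k m = drop k (take (suc m) P)

-- m is the index of the matching downstep of the upstep at index k:
-- the last step of the shortest Dyck subpath starting at k.
Match : Path → ℕ → ℕ → Set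
Match P k m = drop k P ≢ [] × k ≤ m × m < length P × IsDyck (slice P k m) ×
  (∀ m' → k ≤ m' → m' < m → ¬ IsDyck (slice P k m'))

-- height of the occurrence of DUU at index i: height of the vertex
-- between its D and its first U
occHeight : Path → ℕ → ℕ
occHeight P i = level (take (suc i) P)

SkelBody : Path → Path → Path → Set
SkelBody P S Q = Σ ℕ λ i → Σ ℕ λ m →
  DUUat P i ×
  (∀ j → DUUat P j → occHeight P i ≤ occHeight P j) ×
  (∀ j → DUUat P j → occHeight P j ≡ occHeight P i → j ≤ i) ×
  -- m: matching downstep of the middle U (index i+1)
  Match P (suc i) m ×
  -- Q from step h+1 through step m (1-indexed), A = first h steps, B = rest
  Q ≡ slice P (occHeight P i) m ×
  S ≡ take (occHeight P i) P ++ drop (suc m) P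

data Pos : Set where
  top bot : Pos

opp : Pos → Pos
opp top = bot
opp bot = top

peakIdx : Path → ℕ
peakIdx (U ∷ D ∷ w) = 0
peakIdx []          = 0
peakIdx (x ∷ w)     = suc (peakIdx w)

insert : Pos → Path → Path → Path
insert bot S Q = take (peakIdx S) S ++ Q ++ drop (peakIdx S) S
insert top S Q = take (suc (peakIdx S)) S ++ Q ++ drop (suc (peakIdx S)) S

HasPos : Path → Path → Path → Pos → Set
HasPos P S Q pos = P ≡ insert pos S Q

parityPos : ℕ → Pos → Pos
parityPos zero p          = opp p
parityPos (suc zero) p    = p
parityPos (suc (suc h)) p = parityPos h p

-- A primitive path containing DUU is the insertion of its body B into its skeleton S,
-- and the skeletons are generated from the peak UD by S ↦ U S (UD)^j D. Unfolding the
-- decomposition U Q (UD)^i D that defines F gives F(U X (UD)^j D) = U^j F(U X D) D^j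
-- and F(U U R D D) = U F(R) U D D. Hence F maps skeletons to skeletons and bodies to
-- bodies, and, by induction along the generation of S, F(P) is F(B) inserted into F(S).
-- In the second identity R moves from just after a peak upstep to just before one, so
-- each level of the skeleton exchanges top and bot, while at the peak UD the position
-- is kept: the position of F(P) is pos for odd height and pos' for even height. Since the
-- skeleton/body decomposition is unique, it is the one of F(P).

module Submission where

open import Defs
open import Data.Nat using (ℕ; zero; suc; _+_; _∸_; _⊔_; _≤_; _<_; z≤n; s≤s)
open import Data.Nat.Properties
open import Data.List using (List; []; _∷_; _++_; take; drop; length; reverse; replicate; [_])
open import Data.List.Properties
  using (++-assoc; ++-identityʳ; ++-conicalˡ; ++-conicalʳ; length-++; length-replicate; reverse-++;
         reverse-involutive; ∷-injectiveʳ; ∷ʳ-injective; ++-monoid;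
         length-++-≤ˡ; length-++-≤ʳ; take++drop≡id)
open import Data.List.Reverse using (reverseView; []; _∶_∶ʳ_)
open import Data.Maybe using (just)
open import Data.Maybe.Properties using (just-injective)
open import Data.Product using (_×_; _,_; map₁; proj₁; proj₂; Σ-syntax)
open import Data.Sum using (_⊎_; inj₁; inj₂)
open import Data.Empty using (⊥-elim)
open import Relation.Binary.PropositionalEquality hiding ([_])
open import Function using (_∘_; _⟨_⟩_; case_of_)
open import Relation.Binary.Definitions using (tri<; tri≈; tri>)
open import Relation.Nullary using (¬_; yes; no)
open import Algebra.Solver.Monoid (++-monoid Step) using (solve; _⊜_; _⊕_)

take-++ˡ : ∀ {A : Set} n (xs ys : List A) → n ≤ length xs → take n (xs ++ ys) ≡ take n xs
take-++ˡ zero    xs       ys p       = refl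
take-++ˡ (suc n) (x ∷ xs) ys (s≤s p) = cong (x ∷_) (take-++ˡ n xs ys p)

take-++ʳ : ∀ {A : Set} n (xs ys : List A) → take (length xs + n) (xs ++ ys) ≡ xs ++ take n ys
take-++ʳ n []       ys = refl
take-++ʳ n (x ∷ xs) ys = cong (x ∷_) (take-++ʳ n xs ys)

take-length-++ : ∀ {A : Set} (xs ys : List A) → take (length xs) (xs ++ ys) ≡ xs
take-length-++ []       ys = refl
take-length-++ (x ∷ xs) ys = cong (x ∷_) (take-length-++ xs ys)

drop-length-++ : ∀ {A : Set} (xs ys : List A) → drop (length xs) (xs ++ ys) ≡ ys
drop-length-++ []       ys = refl
drop-length-++ (x ∷ xs) ys = drop-length-++ xs ys

++-∷ʳ-split : ∀ {A : Set} (xs ys zs : List A) x → xs ++ ys ≡ zs ++ [ x ] → ys ≢ [] →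
              Σ[ ys′ ∈ List A ] (ys ≡ ys′ ++ [ x ] × xs ++ ys′ ≡ zs)
++-∷ʳ-split xs ys zs x e ys≢[] with reverseView ys
... | [] = ⊥-elim (ys≢[] refl)
... | ys′ ∶ _ ∶ʳ y with ∷ʳ-injective (xs ++ ys′) zs (++-assoc xs ys′ [ y ] ⟨ trans ⟩ e)
...   | xs++ys′≡zs , refl = ys′ , refl , xs++ys′≡zs

Us Ds UDs : ℕ → Path
Us n = replicate n U
Ds n = replicate n D
UDs zero    = []
UDs (suc j) = U ∷ D ∷ UDs j

wrap : Path → Path
wrap r = U ∷ r ++ [ D ]

lift : ℕ → Path → Path
lift m w = Us m ++ w ++ Ds m

Us-+-++ : ∀ m n w → Us m ++ Us n ++ w ≡ Us (m + n) ++ w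
Us-+-++ zero    n w = refl
Us-+-++ (suc m) n w = cong (U ∷_) (Us-+-++ m n w)

Us-suc-++ : ∀ k w → Us (suc k) ++ w ≡ Us k ++ U ∷ w
Us-suc-++ k w = trans (cong (λ n → Us n ++ w) (+-comm 1 k)) (sym (Us-+-++ k 1 w))

Ds-+ : ∀ m n → Ds (m + n) ≡ Ds n ++ Ds m
Ds-+ zero    n = sym (++-identityʳ (Ds n))
Ds-+ (suc m) n = trans (cong (D ∷_) (Ds-+ m n)) (sym (Ds-++-D∷ n (Ds m)))
  where
  Ds-++-D∷ : ∀ n w → Ds n ++ D ∷ w ≡ D ∷ Ds n ++ w
  Ds-++-D∷ zero    w = refl
  Ds-++-D∷ (suc n) w = cong (D ∷_) (Ds-++-D∷ n w)

lift-+ : ∀ m n w → lift (m + n) w ≡ lift m (lift n w)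
lift-+ m n w = begin
  Us (m + n) ++ w ++ Ds (m + n)           ≡⟨ cong (λ z → Us (m + n) ++ w ++ z) (Ds-+ m n) ⟩
  Us (m + n) ++ w ++ Ds n ++ Ds m         ≡⟨ sym (Us-+-++ m n _) ⟩
  Us m ++ Us n ++ w ++ Ds n ++ Ds m       ≡⟨ cong (Us m ++_) (solve 4 (λ b x c d → b ⊕ x ⊕ c ⊕ d ⊜ (b ⊕ x ⊕ c) ⊕ d)
                                                                 refl (Us n) w (Ds n) (Ds m)) ⟩
  Us m ++ (Us n ++ w ++ Ds n) ++ Ds m     ∎
  where open ≡-Reasoning

lift-suc : ∀ m w → lift (suc m) w ≡ wrap (lift m w)
lift-suc = lift-+ 1

take-Us-++ : ∀ k w → take k (Us k ++ w) ≡ Us k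
take-Us-++ zero    w = refl
take-Us-++ (suc k) w = cong (U ∷_) (take-Us-++ k w)

drop-Us-++ : ∀ k w → drop k (Us k ++ w) ≡ w
drop-Us-++ zero    w = refl
drop-Us-++ (suc k) w = drop-Us-++ k w

take-Us-+ : ∀ n k w → take (n + k) (Us n ++ w) ≡ Us n ++ take k w
take-Us-+ zero    k w = refl
take-Us-+ (suc n) k w = cong (U ∷_) (take-Us-+ n k w)

drop-Us-+ : ∀ n k w → drop (n + k) (Us n ++ w) ≡ drop k w
drop-Us-+ zero    k w = refl
drop-Us-+ (suc n) k w = drop-Us-+ n k w

UDs-+ : ∀ i j → UDs i ++ UDs j ≡ UDs (i + j)
UDs-+ zero    j = refl
UDs-+ (suc i) j = cong (λ z → U ∷ D ∷ z) (UDs-+ i j)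

UDs-++-UD : ∀ j → UDs j ++ U ∷ D ∷ [] ≡ UDs (suc j)
UDs-++-UD zero    = refl
UDs-++-UD (suc j) = cong (λ z → U ∷ D ∷ z) (UDs-++-UD j)

walk-++ : ∀ h xs ys {k} → walk h xs ≡ just k → walk h (xs ++ ys) ≡ walk k ys
walk-++ h       []       ys refl = refl
walk-++ h       (U ∷ xs) ys e    = walk-++ (suc h) xs ys e
walk-++ (suc h) (D ∷ xs) ys e    = walk-++ h xs ys e

walk-shift : ∀ n h w {k} → walk h w ≡ just k → walk (n + h) w ≡ just (n + k)
walk-shift n h       []      refl = refl
walk-shift n h       (U ∷ w) e    =
  trans (cong (λ z → walk z w) (sym (+-suc n h))) (walk-shift n (suc h) w e)
walk-shift n (suc h) (D ∷ w) e    =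
  trans (cong (λ z → walk z (D ∷ w)) (+-suc n h)) (walk-shift n h w e)

walk-take : ∀ n h w {k} → walk h w ≡ just k → Σ[ l ∈ ℕ ] walk h (take n w) ≡ just l
walk-take zero    h       w       e = h , refl
walk-take (suc n) h       []      e = h , refl
walk-take (suc n) h       (U ∷ w) e = walk-take n (suc h) w e
walk-take (suc n) (suc h) (D ∷ w) e = walk-take n h w e

walk-++⁻ˡ : ∀ h xs ys {k} → walk h (xs ++ ys) ≡ just k → Σ[ l ∈ ℕ ] walk h xs ≡ just l
walk-++⁻ˡ h       []       ys e = h , refl
walk-++⁻ˡ h       (U ∷ xs) ys e = walk-++⁻ˡ (suc h) xs ys e
walk-++⁻ˡ (suc h) (D ∷ xs) ys e = walk-++⁻ˡ h xs ys e

walk-count : ∀ h w {k} → walk h w ≡ just k → countU w + h ≡ countD w + k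
walk-count h       []      refl = refl
walk-count h       (U ∷ w) e    = trans (sym (+-suc (countU w) h)) (walk-count (suc h) w e)
walk-count (suc h) (D ∷ w) e    = trans (+-suc (countU w) h) (cong suc (walk-count h w e))

walk⇒level : ∀ w {l} → walk 0 w ≡ just l → level w ≡ l
walk⇒level w {l} e = begin
  countU w ∸ countD w       ≡⟨ cong (_∸ countD w) (sym (+-identityʳ (countU w))) ⟩
  countU w + 0 ∸ countD w   ≡⟨ cong (_∸ countD w) (walk-count 0 w e) ⟩
  countD w + l ∸ countD w   ≡⟨ m+n∸m≡n (countD w) l ⟩
  l                         ∎
  where open ≡-Reasoning

walk-Us-++ : ∀ n h w → walk h (Us n ++ w) ≡ walk (n + h) w
walk-Us-++ zero    h w = refl
walk-Us-++ (suc n) h w = trans (walk-Us-++ n (suc h) w) (cong (λ z → walk z w) (+-suc n h))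

data Dyck : Path → Set where
  nil  : Dyck []
  node : ∀ {a b} → Dyck a → Dyck b → Dyck (U ∷ a ++ D ∷ b)

Dyck⇒walk : ∀ {w} → Dyck w → ∀ h → walk h w ≡ just h
Dyck⇒walk nil                 h = refl
Dyck⇒walk (node {a} {b} da db) h =
  trans (walk-++ (suc h) a (D ∷ b) (Dyck⇒walk da (suc h))) (Dyck⇒walk db h)

Dyck⇒IsDyck : ∀ {w} → Dyck w → IsDyck w
Dyck⇒IsDyck d = Dyck⇒walk d 0

-- Words that descend from level n to level 0 without going below it.
data Descent : ℕ → Path → Set where
  done : ∀ {d} → Dyck d → Descent 0 d
  step : ∀ {n d r} → Dyck d → Descent n r → Descent (suc n) (d ++ D ∷ r)

Descent-wrap-++ : ∀ {n a r} → Dyck a → Descent n r → Descent n (wrap a ++ r)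
Descent-wrap-++ {a = a} da (done {d} dd) =
  subst (Descent 0) (sym (cong (U ∷_) (++-assoc a [ D ] d))) (done (node da dd))
Descent-wrap-++ {a = a} da (step {n} {d} {r} dd x) =
  subst (Descent (suc n)) eq (step (node da dd) x)
  where
  eq : (U ∷ a ++ D ∷ d) ++ D ∷ r ≡ wrap a ++ d ++ D ∷ r
  eq = cong (U ∷_) (trans (++-assoc a (D ∷ d) (D ∷ r)) (sym (++-assoc a [ D ] (d ++ D ∷ r))))

walk⇒Descent : ∀ n w → walk n w ≡ just 0 → Descent n w
walk⇒Descent zero    []      e = done nil
walk⇒Descent (suc n) (D ∷ w) e = step nil (walk⇒Descent n w e)
walk⇒Descent n       (U ∷ w) e with walk⇒Descent (suc n) w e
... | step {d = d} {r} dd x =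
  subst (Descent n) (cong (U ∷_) (++-assoc d [ D ] r)) (Descent-wrap-++ dd x)

IsDyck⇒Dyck : ∀ {w} → IsDyck w → Dyck w
IsDyck⇒Dyck {w} e with walk⇒Descent 0 w e
... | done d = d

Dyck-++ : ∀ {a b} → Dyck a → Dyck b → Dyck (a ++ b)
Dyck-++         nil                   db = db
Dyck-++ {b = b} (node {x} {y} dx dy) db =
  subst Dyck (sym (cong (U ∷_) (++-assoc x (D ∷ y) b))) (node dx (Dyck-++ dy db))

Dyck-wrap : ∀ {r} → Dyck r → Dyck (wrap r)
Dyck-wrap d = node d nil

Dyck-UDs : ∀ j → Dyck (UDs j)
Dyck-UDs zero    = nil
Dyck-UDs (suc j) = node nil (Dyck-UDs j)

Dyck-lift : ∀ m {w} → Dyck w → Dyck (lift m w)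
Dyck-lift zero    {w} dw = subst Dyck (sym (++-identityʳ w)) dw
Dyck-lift (suc m) {w} dw = subst Dyck (sym (lift-suc m w)) (Dyck-wrap (Dyck-lift m dw))

Dyck-∷ʳD : ∀ {w} → Dyck w → w ≢ [] → Σ[ w₀ ∈ Path ] w ≡ w₀ ++ [ D ]
Dyck-∷ʳD nil                                 w≢[] = ⊥-elim (w≢[] refl)
Dyck-∷ʳD (node {a} {[]} da nil)              _    = U ∷ a , refl
Dyck-∷ʳD (node {a} da (node {x} {y} dx dy)) _    with Dyck-∷ʳD (node dx dy) (λ ())
... | w₀ , eq = U ∷ a ++ D ∷ w₀ ,
  cong (U ∷_) (trans (cong (λ z → a ++ D ∷ z) eq) (sym (++-assoc a (D ∷ w₀) [ D ])))

Dyck-insert : ∀ A B C → Dyck (A ++ C) → Dyck B → Dyck (A ++ B ++ C)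
Dyck-insert A B C dAC dB with walk-++⁻ˡ 0 A C (Dyck⇒IsDyck dAC)
... | l , walkA = IsDyck⇒Dyck (begin
  walk 0 (A ++ B ++ C) ≡⟨ walk-++ 0 A (B ++ C) walkA ⟩
  walk l (B ++ C)      ≡⟨ walk-++ l B C (Dyck⇒walk dB l) ⟩
  walk l C             ≡⟨ sym (walk-++ 0 A C walkA) ⟩
  walk 0 (A ++ C)      ≡⟨ Dyck⇒IsDyck dAC ⟩
  just 0               ∎)
  where open ≡-Reasoning

Dyck-insert-at : ∀ i {S B} → Dyck S → Dyck B → Dyck (take i S ++ B ++ drop i S)
Dyck-insert-at i {S} dS = Dyck-insert (take i S) _ (drop i S) (subst Dyck (sym (take++drop≡id i S)) dS)

wrap-Primitive : ∀ {r} → Dyck r → Primitive (wrap r)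
wrap-Primitive {r} dr = Dyck⇒IsDyck (Dyck-wrap dr) , (λ ()) , noDyckPrefix
  where
  noDyckPrefix : ∀ k → 0 < k → k < length (wrap r) → ¬ IsDyck (take k (wrap r))
  noDyckPrefix (suc k) _ (s≤s k<) e with walk-take k 0 r (Dyck⇒IsDyck dr)
  ... | l , walk-k = 1+n≢0 (just-injective (begin
    just (suc l)          ≡⟨ sym (walk-shift 1 0 (take k r) walk-k) ⟩
    walk 1 (take k r)     ≡⟨ cong (walk 1) (sym (take-++ˡ k r [ D ] k≤r)) ⟩
    walk 1 (take k (r ++ [ D ])) ≡⟨ e ⟩
    just 0                ∎))
    where
    open ≡-Reasoning
    k≤r : k ≤ length r
    k≤r = ≤-pred (subst (k <_) (trans (length-++ r) (+-comm (length r) 1)) k<)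

Primitive⇒wrap : ∀ {P} → Primitive P → Σ[ r ∈ Path ] (Dyck r × P ≡ wrap r)
Primitive⇒wrap {P} (dP , P≢[] , noPrefix) with IsDyck⇒Dyck {P} dP
... | nil                      = ⊥-elim (P≢[] refl)
... | node {a} {[]} da nil     = a , da , refl
... | node {a} {y ∷ ys} da db  =
  ⊥-elim (noPrefix (length c) (s≤s z≤n) c<P (subst IsDyck (sym prefix-c) (Dyck⇒IsDyck (Dyck-wrap da))))
  where
  c = wrap a
  P≡c++ : U ∷ a ++ D ∷ y ∷ ys ≡ c ++ y ∷ ys
  P≡c++ = cong (U ∷_) (sym (++-assoc a [ D ] (y ∷ ys)))
  prefix-c : take (length c) (U ∷ a ++ D ∷ y ∷ ys) ≡ c
  prefix-c = trans (cong (take (length c)) P≡c++) (take-length-++ c (y ∷ ys))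
  c<P : length c < length (U ∷ a ++ D ∷ y ∷ ys)
  c<P = subst (length c <_) (sym (trans (cong length P≡c++) (length-++ c)))
          (m<m+n (length c) (s≤s z≤n))

hgo-≥ : ∀ h w → h ≤ hgo h w
hgo-≥ h []      = ≤-refl
hgo-≥ h (U ∷ w) = m≤m⊔n h _
hgo-≥ h (D ∷ w) = m≤m⊔n h _

hgo-++ : ∀ h xs ys {k} → walk h xs ≡ just k → hgo h (xs ++ ys) ≡ hgo h xs ⊔ hgo k ys
hgo-++ h       []       ys refl = sym (m≤n⇒m⊔n≡n (hgo-≥ h ys))
hgo-++ h       (U ∷ xs) ys e    =
  trans (cong (h ⊔_) (hgo-++ (suc h) xs ys e)) (sym (⊔-assoc h (hgo (suc h) xs) _))
hgo-++ (suc h) (D ∷ xs) ys e    =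
  trans (cong (suc h ⊔_) (hgo-++ h xs ys e)) (sym (⊔-assoc (suc h) (hgo h xs) _))

hgo-suc : ∀ h w {k} → walk h w ≡ just k → hgo (suc h) w ≡ suc (hgo h w)
hgo-suc h       []      e = refl
hgo-suc h       (U ∷ w) e = cong (suc h ⊔_) (hgo-suc (suc h) w e)
hgo-suc (suc h) (D ∷ w) e = cong (suc (suc h) ⊔_) (hgo-suc h w e)

height-wrap : ∀ {Z} → Dyck Z → height (wrap Z) ≡ suc (height Z)
height-wrap {Z} dZ = trans (hgo-++ 1 Z [ D ] (Dyck⇒walk dZ 1))
  (trans (cong (_⊔ 1) (hgo-suc 0 Z (Dyck⇒walk dZ 0))) (m≥n⇒m⊔n≡m (s≤s z≤n)))

height-++ : ∀ {X} Y → Dyck X → height (X ++ Y) ≡ height X ⊔ height Y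
height-++ {X} Y dX = hgo-++ 0 X Y (Dyck⇒walk dX 0)

height-UDs : ∀ j → height (UDs j) ≤ 1
height-UDs zero    = z≤n
height-UDs (suc j) = subst (_≤ 1) (sym (height-++ (UDs j) (Dyck-wrap nil))) (⊔-lub ≤-refl (height-UDs j))

spl-++ : ∀ n Z rest {k} → walk n Z ≡ just k → spl (suc n) (Z ++ rest) ≡ map₁ (Z ++_) (spl (suc k) rest)
spl-++ n       []      rest refl = refl
spl-++ n       (U ∷ Z) rest e    = cong (map₁ (U ∷_)) (spl-++ (suc n) Z rest e)
spl-++ (suc n) (D ∷ Z) rest e    = cong (map₁ (D ∷_)) (spl-++ n Z rest e)

firstComp-node : ∀ {a} b → Dyck a → firstComp (U ∷ a ++ D ∷ b) ≡ (wrap a , b)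
firstComp-node {a} b da = cong (map₁ (U ∷_)) (spl-++ 0 a (D ∷ b) (Dyck⇒IsDyck da))

middle-wrap : ∀ a → middle (wrap a) ≡ a
middle-wrap a = trans (cong (λ z → reverse (drop 1 z)) (reverse-++ a [ D ])) (reverse-involutive a)

F'-node-[] : ∀ n {a} → Dyck a → F' (suc n) (wrap a) ≡ Fprim n (wrap a)
F'-node-[] n da rewrite firstComp-node [] da = refl

F'-node-∷ : ∀ n {a} y r → Dyck a → F' (suc n) (U ∷ a ++ D ∷ y ∷ r) ≡ F' n (wrap a) ++ F' n (y ∷ r)
F'-node-∷ n y r da rewrite firstComp-node (y ∷ r) da = refl

-- The nonempty, non-primitive Dyck paths ending with DD: at least two components,
-- the last of which has size at least two.
data Body : Path → Set where
  body : ∀ {x y z} → Dyck x → Dyck y → Dyck z → z ≢ [] → Body ((U ∷ x ++ D ∷ y) ++ wrap z)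

Body⇒Dyck : ∀ {q} → Body q → Dyck q
Body⇒Dyck (body dx dy dz _) = Dyck-++ (node dx dy) (Dyck-wrap dz)

Body-nonempty : ∀ {q} → Body q → q ≢ []
Body-nonempty (body _ _ _ _) ()

-- The interior of a primitive path, written Q (UD)^j as in the definition of F,
-- according to whether Q is empty, primitive, or neither.
data Shape : Path → Set where
  shape-UDs  : ∀ j → Shape (UDs j)
  shape-wrap : ∀ j {r} → Dyck r → r ≢ [] → Shape (wrap r ++ UDs j)
  shape-body : ∀ j {q} → Body q → Shape (q ++ UDs j)

shape : ∀ {a} → Dyck a → Shape a
shape nil = shape-UDs 0
shape (node {x} {y} dx dy) with shape dy
shape (node {[]}     dx dy) | shape-UDs j = shape-UDs (suc j)
shape (node {x ∷ xs} dx dy) | shape-UDs j =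
  subst Shape (cong (U ∷_) (++-assoc (x ∷ xs) [ D ] (UDs j))) (shape-wrap j dx (λ ()))
shape (node {x} dx dy) | shape-wrap j {r} dr r≢[] =
  subst Shape eq (shape-body j (body dx nil dr r≢[]))
  where
  eq : ((U ∷ x ++ [ D ]) ++ wrap r) ++ UDs j ≡ U ∷ x ++ D ∷ wrap r ++ UDs j
  eq = solve 5 (λ u x d w R → ((u ⊕ x ⊕ d) ⊕ w) ⊕ R ⊜ u ⊕ x ⊕ d ⊕ w ⊕ R)
         refl [ U ] x [ D ] (wrap r) (UDs j)
shape (node {x} dx dy) | shape-body j (body {x₀} {y₀} {z} dx₀ dy₀ dz z≢[]) =
  subst Shape eq (shape-body j (body dx (node dx₀ dy₀) dz z≢[]))
  where
  eq : ((U ∷ x ++ D ∷ U ∷ x₀ ++ D ∷ y₀) ++ wrap z) ++ UDs j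
     ≡ U ∷ x ++ D ∷ ((U ∷ x₀ ++ D ∷ y₀) ++ wrap z) ++ UDs j
  eq = solve 6 (λ u x d v w R → ((u ⊕ x ⊕ d ⊕ v) ⊕ w) ⊕ R ⊜ u ⊕ x ⊕ d ⊕ (v ⊕ w) ⊕ R)
         refl [ U ] x [ D ] (U ∷ x₀ ++ D ∷ y₀) (wrap z) (UDs j)

EndsDD : Path → Set
EndsDD q = q ≡ [] ⊎ Σ[ q₀ ∈ Path ] q ≡ q₀ ++ D ∷ D ∷ []

wrap-EndsDD : ∀ {r} → Dyck r → r ≢ [] → EndsDD (wrap r)
wrap-EndsDD dr r≢[] with Dyck-∷ʳD dr r≢[]
... | r₀ , refl = inj₂ (U ∷ r₀ , cong (U ∷_) (++-assoc r₀ [ D ] [ D ]))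

Body-EndsDD : ∀ {q} → Body q → EndsDD q
Body-EndsDD (body {x} {y} {z} dx dy dz z≢[]) with wrap-EndsDD dz z≢[]
... | inj₂ (w₀ , eq) = inj₂ ((U ∷ x ++ D ∷ y) ++ w₀ ,
  trans (cong ((U ∷ x ++ D ∷ y) ++_) eq) (sym (++-assoc (U ∷ x ++ D ∷ y) w₀ (D ∷ D ∷ []))))

DUs : ℕ → Path
DUs zero    = []
DUs (suc j) = D ∷ U ∷ DUs j

DUs-∷ʳ : ∀ j → DUs j ++ D ∷ U ∷ [] ≡ D ∷ U ∷ DUs j
DUs-∷ʳ zero    = refl
DUs-∷ʳ (suc j) = cong (λ z → D ∷ U ∷ z) (DUs-∷ʳ j)

reverse-UDs : ∀ j → reverse (UDs j) ≡ DUs j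
reverse-UDs zero    = refl
reverse-UDs (suc j) =
  trans (reverse-++ (U ∷ D ∷ []) (UDs j)) (trans (cong (_++ D ∷ U ∷ []) (reverse-UDs j)) (DUs-∷ʳ j))

stripRev-DUs : ∀ j q → EndsDD q → stripRev (DUs j ++ reverse q) ≡ (j , reverse q)
stripRev-DUs (suc j) q q-DD = cong (map₁ suc) (stripRev-DUs j q q-DD)
stripRev-DUs zero .[] (inj₁ refl) = refl
stripRev-DUs zero .(q₀ ++ D ∷ D ∷ []) (inj₂ (q₀ , refl)) rewrite reverse-++ q₀ (D ∷ D ∷ []) = refl

Fprim-≡ : ∀ n c {i rQ} → stripRev (reverse (middle c)) ≡ (i , rQ) → Fprim n c ≡ Fcase n i (reverse rQ)
Fprim-≡ n c eq rewrite eq = refl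

Fprim-shape : ∀ n q j → EndsDD q → Fprim n (wrap (q ++ UDs j)) ≡ Fcase n j q
Fprim-shape n q j q-DD =
  trans (Fprim-≡ n (wrap (q ++ UDs j)) strip) (cong (Fcase n j) (reverse-involutive q))
  where
  open ≡-Reasoning
  strip : stripRev (reverse (middle (wrap (q ++ UDs j)))) ≡ (j , reverse q)
  strip = begin
    stripRev (reverse (middle (wrap (q ++ UDs j)))) ≡⟨ cong (λ z → stripRev (reverse z)) (middle-wrap (q ++ UDs j)) ⟩
    stripRev (reverse (q ++ UDs j))                 ≡⟨ cong stripRev (reverse-++ q (UDs j)) ⟩
    stripRev (reverse (UDs j) ++ reverse q)         ≡⟨ cong (λ z → stripRev (z ++ reverse q)) (reverse-UDs j) ⟩
    stripRev (DUs j ++ reverse q)                   ≡⟨ stripRev-DUs j q q-DD ⟩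
    (j , reverse q)                                 ∎

Fprim-UDs : ∀ n j → Fprim n (wrap (UDs j)) ≡ lift (suc j) []
Fprim-UDs n j = Fprim-shape n [] j (inj₁ refl)

Fprim-wrap : ∀ n j {r} → Dyck r → r ≢ [] →
             Fprim n (wrap (wrap r ++ UDs j)) ≡ Us (suc j) ++ F' n r ++ U ∷ D ∷ Ds (suc j)
Fprim-wrap n j {r} dr r≢[] rewrite Fprim-shape n (wrap r) j (wrap-EndsDD dr r≢[])
                                 | firstComp-node [] dr | middle-wrap r = refl

Fcase-node : ∀ n i {a} b → Dyck a → b ≢ [] → Fcase n i (U ∷ a ++ D ∷ b) ≡ lift (suc i) (F' n (U ∷ a ++ D ∷ b))
Fcase-node n i []      da b≢[] = ⊥-elim (b≢[] refl)
Fcase-node n i (y ∷ r) da _    rewrite firstComp-node (y ∷ r) da = refl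

Fcase-body : ∀ n i {q} → Body q → Fcase n i q ≡ lift (suc i) (F' n q)
Fcase-body n i (body {x} {y} {z} dx _ _ _) =
  subst (λ w → Fcase n i w ≡ lift (suc i) (F' n w)) (sym q≡node)
    (Fcase-node n i (y ++ wrap z) dx (λ eq → case ++-conicalʳ y (wrap z) eq of λ ()))
  where
  q≡node : (U ∷ x ++ D ∷ y) ++ wrap z ≡ U ∷ x ++ D ∷ y ++ wrap z
  q≡node = cong (U ∷_) (++-assoc x (D ∷ y) (wrap z))

Fprim-body : ∀ n j {q} → Body q → Fprim n (wrap (q ++ UDs j)) ≡ lift (suc j) (F' n q)
Fprim-body n j {q} bq = trans (Fprim-shape n q j (Body-EndsDD bq)) (Fcase-body n j bq)

length-≤-wrap : ∀ r → length r ≤ length (wrap r)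
length-≤-wrap r = ≤-trans (length-++-≤ˡ r) (n≤1+n _)

length-≤-++-++ : ∀ (q x y : Path) → length q ≤ length ((q ++ x) ++ y)
length-≤-++-++ q x y = ≤-trans (length-++-≤ˡ q) (length-++-≤ˡ (q ++ x))

length-wrap-≤-node : ∀ a y r → length (wrap a) ≤ length (a ++ D ∷ y ∷ r)
length-wrap-≤-node []      y r = s≤s (s≤s z≤n)
length-wrap-≤-node (x ∷ a) y r = s≤s (length-wrap-≤-node a y r)

length-≤-node : ∀ a b → length b ≤ length (a ++ D ∷ b)
length-≤-node a b = ≤-trans (n≤1+n (length b)) (length-++-≤ʳ (D ∷ b) {a})

mutual
  F'-fuel-suc : ∀ n {w} → Dyck w → length w ≤ n → F' n w ≡ F' (suc n) w
  F'-fuel-suc zero    nil _ = refl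
  F'-fuel-suc (suc n) nil _ = refl
  F'-fuel-suc (suc n) (node {a} {[]} da nil) (s≤s a≤n) =
    trans (F'-node-[] n da) (trans (Fprim-fuel-suc n da a≤n) (sym (F'-node-[] (suc n) da)))
  F'-fuel-suc (suc n) (node {a} {y ∷ r} da db) (s≤s w≤n) =
    trans (F'-node-∷ n y r da)
      (trans (cong₂ _++_ (F'-fuel-suc n (Dyck-wrap da) (≤-trans (length-wrap-≤-node a y r) w≤n))
                         (F'-fuel-suc n db (≤-trans (length-≤-node a (y ∷ r)) w≤n)))
             (sym (F'-node-∷ (suc n) y r da)))

  Fprim-fuel-suc : ∀ n {a} → Dyck a → length (a ++ [ D ]) ≤ n → Fprim n (wrap a) ≡ Fprim (suc n) (wrap a)
  Fprim-fuel-suc n da a≤n with shape da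
  ... | shape-UDs j = trans (Fprim-UDs n j) (sym (Fprim-UDs (suc n) j))
  ... | shape-wrap j {r} dr r≢[] =
    trans (Fprim-wrap n j dr r≢[])
      (trans (cong (λ z → Us (suc j) ++ z ++ U ∷ D ∷ Ds (suc j)) (F'-fuel-suc n dr r≤n))
             (sym (Fprim-wrap (suc n) j dr r≢[])))
    where
    r≤n : length r ≤ n
    r≤n = ≤-trans (length-≤-wrap r) (≤-trans (length-≤-++-++ (wrap r) (UDs j) [ D ]) a≤n)
  ... | shape-body j {q} bq =
    trans (Fprim-body n j bq)
      (trans (cong (lift (suc j)) (F'-fuel-suc n (Body⇒Dyck bq) q≤n))
             (sym (Fprim-body (suc n) j bq)))
    where
    q≤n : length q ≤ n
    q≤n = ≤-trans (length-≤-++-++ q (UDs j) [ D ]) a≤n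

F'-fuel : ∀ n {w} → Dyck w → length w ≤ n → F' n w ≡ F w
F'-fuel n {w} dw w≤n with m≤n⇒∃[o]m+o≡n w≤n
... | d , refl = extra d
  where
  extra : ∀ d → F' (length w + d) w ≡ F w
  extra zero    = cong (λ z → F' z w) (+-identityʳ (length w))
  extra (suc d) = trans (cong (λ z → F' z w) (+-suc (length w) d))
    (trans (sym (F'-fuel-suc (length w + d) dw (m≤m+n (length w) d))) (extra d))

F-wrap-Fprim : ∀ {a} → Dyck a → F (wrap a) ≡ Fprim (length (a ++ [ D ])) (wrap a)
F-wrap-Fprim da = F'-node-[] _ da

F-wrap-UDs : ∀ j → F (wrap (UDs j)) ≡ lift (suc j) []
F-wrap-UDs j = trans (F-wrap-Fprim (Dyck-UDs j)) (Fprim-UDs _ j)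

F-wrap-wrap-UDs : ∀ j {r} → Dyck r → r ≢ [] → F (wrap (wrap r ++ UDs j)) ≡ lift (suc j) (F r ++ U ∷ D ∷ [])
F-wrap-wrap-UDs j {r} dr r≢[] =
  trans (F-wrap-Fprim (Dyck-++ (Dyck-wrap dr) (Dyck-UDs j)))
    (trans (Fprim-wrap _ j dr r≢[])
      (trans (cong (λ z → Us (suc j) ++ z ++ U ∷ D ∷ Ds (suc j)) (F'-fuel _ dr r≤))
             (cong (Us (suc j) ++_) (sym (++-assoc (F r) (U ∷ D ∷ []) (Ds (suc j)))))))
  where
  r≤ : length r ≤ length ((wrap r ++ UDs j) ++ [ D ])
  r≤ = ≤-trans (length-≤-wrap r) (length-≤-++-++ (wrap r) (UDs j) [ D ])

F-wrap-body-UDs : ∀ j {q} → Body q → F (wrap (q ++ UDs j)) ≡ lift (suc j) (F q)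
F-wrap-body-UDs j {q} bq =
  trans (F-wrap-Fprim (Dyck-++ (Body⇒Dyck bq) (Dyck-UDs j)))
    (trans (Fprim-body _ j bq)
           (cong (lift (suc j)) (F'-fuel _ (Body⇒Dyck bq) q≤)))
  where
  q≤ : length q ≤ length ((q ++ UDs j) ++ [ D ])
  q≤ = length-≤-++-++ q (UDs j) [ D ]

F-node : ∀ {a b} → Dyck a → Dyck b → F (U ∷ a ++ D ∷ b) ≡ F (wrap a) ++ F b
F-node {a} {[]}    da db = sym (++-identityʳ _)
F-node {a} {y ∷ r} da db =
  trans (F'-node-∷ _ y r da)
    (cong₂ _++_ (F'-fuel _ (Dyck-wrap da) (length-wrap-≤-node a y r))
                (F'-fuel _ db (length-≤-node a (y ∷ r))))

F-++ : ∀ {a b} → Dyck a → Dyck b → F (a ++ b) ≡ F a ++ F b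
F-++         nil                  db = refl
F-++ {b = b} (node {x} {y} dx dy) db = begin
  F ((U ∷ x ++ D ∷ y) ++ b)       ≡⟨ cong (λ z → F (U ∷ z)) (++-assoc x (D ∷ y) b) ⟩
  F (U ∷ x ++ D ∷ y ++ b)         ≡⟨ F-node dx (Dyck-++ dy db) ⟩
  F (wrap x) ++ F (y ++ b)        ≡⟨ cong (F (wrap x) ++_) (F-++ dy db) ⟩
  F (wrap x) ++ F y ++ F b        ≡⟨ sym (++-assoc (F (wrap x)) (F y) (F b)) ⟩
  (F (wrap x) ++ F y) ++ F b      ≡⟨ cong (_++ F b) (sym (F-node dx dy)) ⟩
  F (U ∷ x ++ D ∷ y) ++ F b       ∎
  where open ≡-Reasoning

F-UDs : ∀ j → F (UDs j) ≡ UDs j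
F-UDs zero    = refl
F-UDs (suc j) = trans (F-++ (Dyck-wrap nil) (Dyck-UDs j)) (cong (λ z → U ∷ D ∷ z) (F-UDs j))

F-++-UDs : ∀ {X} j → Dyck X → F (X ++ UDs j) ≡ F X ++ UDs j
F-++-UDs j dX = trans (F-++ dX (Dyck-UDs j)) (cong (_ ++_) (F-UDs j))

F-Dyck-≤ : ∀ n {w} → length w ≤ n → Dyck w → Dyck (F w)
F-Dyck-≤ n       _        nil = nil
F-Dyck-≤ (suc n) (s≤s a≤n) (node {a} {[]} da nil) with shape da
... | shape-UDs j = subst Dyck (sym (F-wrap-UDs j)) (Dyck-lift (suc j) nil)
... | shape-wrap j {r} dr r≢[] =
  subst Dyck (sym (F-wrap-wrap-UDs j dr r≢[])) (Dyck-lift (suc j) (Dyck-++ (F-Dyck-≤ n r≤n dr) (Dyck-wrap nil)))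
  where
  r≤n : length r ≤ n
  r≤n = ≤-trans (length-≤-wrap r) (≤-trans (length-≤-++-++ (wrap r) (UDs j) [ D ]) a≤n)
... | shape-body j {q} bq =
  subst Dyck (sym (F-wrap-body-UDs j bq)) (Dyck-lift (suc j) (F-Dyck-≤ n q≤n (Body⇒Dyck bq)))
  where
  q≤n : length q ≤ n
  q≤n = ≤-trans (length-≤-++-++ q (UDs j) [ D ]) a≤n
F-Dyck-≤ (suc n) (s≤s w≤n) (node {a} {y ∷ r} da db) =
  subst Dyck (sym (F-node da db))
    (Dyck-++ (F-Dyck-≤ n (≤-trans (length-wrap-≤-node a y r) w≤n) (Dyck-wrap da))
             (F-Dyck-≤ n (≤-trans (length-≤-node a (y ∷ r)) w≤n) db))

F-Dyck : ∀ {w} → Dyck w → Dyck (F w)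
F-Dyck {w} = F-Dyck-≤ (length w) ≤-refl

F-wrap-∷ : ∀ {a} → Dyck a → Σ[ t ∈ Path ] F (wrap a) ≡ U ∷ t
F-wrap-∷ da with shape da
... | shape-UDs j          = _ , F-wrap-UDs j
... | shape-wrap j dr r≢[] = _ , F-wrap-wrap-UDs j dr r≢[]
... | shape-body j bq      = _ , F-wrap-body-UDs j bq

F-nonempty : ∀ {w} → Dyck w → w ≢ [] → F w ≢ []
F-nonempty nil                  w≢[] = ⊥-elim (w≢[] refl)
F-nonempty (node {a} {b} da db) _    Fw≡[] with F-wrap-∷ da
... | t , Fwrap≡ = case trans (cong (_++ F b) (sym Fwrap≡)) (trans (sym (F-node da db)) Fw≡[]) of λ ()

F-wrap : ∀ {a} → Dyck a → Σ[ a′ ∈ Path ] (Dyck a′ × F (wrap a) ≡ wrap a′ × (a ≢ [] → a′ ≢ []))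
F-wrap da with shape da
... | shape-UDs zero    = [] , nil , refl , λ a≢[] → ⊥-elim (a≢[] refl)
... | shape-UDs (suc j) =
  lift (suc j) [] , Dyck-lift (suc j) nil , trans (F-wrap-UDs (suc j)) (lift-suc (suc j) []) , λ _ ()
... | shape-wrap j {r} dr r≢[] =
  lift j (F r ++ U ∷ D ∷ []) , Dyck-lift j (Dyck-++ (F-Dyck dr) (Dyck-wrap nil)) ,
  trans (F-wrap-wrap-UDs j dr r≢[]) (lift-suc j (F r ++ U ∷ D ∷ [])) ,
  λ _ eq → case ++-conicalʳ (F r) _ (++-conicalˡ _ (Ds j) (++-conicalʳ (Us j) _ eq)) of λ ()
... | shape-body j {q} bq =
  lift j (F q) , Dyck-lift j (F-Dyck (Body⇒Dyck bq)) ,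
  trans (F-wrap-body-UDs j bq) (lift-suc j (F q)) ,
  λ _ eq → F-nonempty (Body⇒Dyck bq) (Body-nonempty bq) (++-conicalˡ (F q) (Ds j) (++-conicalʳ (Us j) _ eq))

F-Body : ∀ {q} → Body q → Body (F q)
F-Body (body {x} {y} {z} dx dy dz z≢[]) with F-wrap dx | F-wrap dz
... | x′ , dx′ , Fx , _ | z′ , dz′ , Fz , z′≢[] =
  subst Body (sym Fq) (body dx′ (F-Dyck dy) dz′ (z′≢[] z≢[]))
  where
  open ≡-Reasoning
  Fq : F ((U ∷ x ++ D ∷ y) ++ wrap z) ≡ (U ∷ x′ ++ D ∷ F y) ++ wrap z′
  Fq = begin
    F ((U ∷ x ++ D ∷ y) ++ wrap z)      ≡⟨ F-++ (node dx dy) (Dyck-wrap dz) ⟩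
    F (U ∷ x ++ D ∷ y) ++ F (wrap z)    ≡⟨ cong₂ _++_ (F-node dx dy) Fz ⟩
    (F (wrap x) ++ F y) ++ wrap z′      ≡⟨ cong (λ w → (w ++ F y) ++ wrap z′) Fx ⟩
    (wrap x′ ++ F y) ++ wrap z′         ≡⟨ cong (λ w → U ∷ w ++ wrap z′) (++-assoc x′ [ D ] (F y)) ⟩
    (U ∷ x′ ++ D ∷ F y) ++ wrap z′      ∎

F-wrap-wrap : ∀ {r} → Dyck r → r ≢ [] → F (wrap (wrap r)) ≡ wrap (F r ++ U ∷ D ∷ [])
F-wrap-wrap {r} dr r≢[] = trans (cong (λ z → F (wrap z)) (sym (++-identityʳ (wrap r)))) (F-wrap-wrap-UDs 0 dr r≢[])

F-wrap-wrap-++-UDs : ∀ {T} j → Dyck T → T ≢ [] → F (wrap (wrap (T ++ UDs j))) ≡ wrap (F T ++ UDs (suc j))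
F-wrap-wrap-++-UDs {T} j dT T≢[] = begin
  F (wrap (wrap (T ++ UDs j)))         ≡⟨ F-wrap-wrap (Dyck-++ dT (Dyck-UDs j)) (T≢[] ∘ ++-conicalˡ T (UDs j)) ⟩
  wrap (F (T ++ UDs j) ++ U ∷ D ∷ [])  ≡⟨ cong (λ z → wrap (z ++ U ∷ D ∷ [])) (F-++-UDs j dT) ⟩
  wrap ((F T ++ UDs j) ++ U ∷ D ∷ [])  ≡⟨ cong wrap (++-assoc (F T) (UDs j) _) ⟩
  wrap (F T ++ UDs j ++ U ∷ D ∷ [])    ≡⟨ cong (λ z → wrap (F T ++ z)) (UDs-++-UD j) ⟩
  wrap (F T ++ UDs (suc j))            ∎
  where open ≡-Reasoning

F-wrap-UDs-shift : ∀ Q i j w → (∀ k → F (wrap (Q ++ UDs k)) ≡ lift (suc k) w) →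
                   F (wrap ((Q ++ UDs i) ++ UDs j)) ≡ lift j (F (wrap (Q ++ UDs i)))
F-wrap-UDs-shift Q i j w FQ = begin
  F (wrap ((Q ++ UDs i) ++ UDs j)) ≡⟨ cong (λ z → F (wrap z)) (trans (++-assoc Q (UDs i) (UDs j)) (cong (Q ++_) (UDs-+ i j))) ⟩
  F (wrap (Q ++ UDs (i + j)))     ≡⟨ FQ (i + j) ⟩
  lift (suc (i + j)) w            ≡⟨ cong (λ n → lift n w) (sym (trans (+-suc j i) (cong suc (+-comm j i)))) ⟩
  lift (j + suc i) w              ≡⟨ lift-+ j (suc i) w ⟩
  lift j (lift (suc i) w)         ≡⟨ cong (lift j) (sym (FQ i)) ⟩
  lift j (F (wrap (Q ++ UDs i)))  ∎
  where open ≡-Reasoning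

-- Appending (UD)^j to X only lengthens the trailing (UD)^i of the decomposition
-- U Q (UD)^i D by which F is defined.
F-wrap-++-UDs : ∀ j {X} → Dyck X → F (wrap (X ++ UDs j)) ≡ lift j (F (wrap X))
F-wrap-++-UDs j dX with shape dX
... | shape-UDs i              = F-wrap-UDs-shift [] i j [] F-wrap-UDs
... | shape-wrap i {r} dr r≢[] = F-wrap-UDs-shift (wrap r) i j _ (λ k → F-wrap-wrap-UDs k dr r≢[])
... | shape-body i {q} bq      = F-wrap-UDs-shift q i j _ (λ k → F-wrap-body-UDs k bq)

-- The primitive DUU-avoiding paths, indexed by height: inside the outer U … D every
-- component but the first is preceded by a D, so it is a peak UD.
data Skeleton : ℕ → Path → Set where
  peak  : Skeleton 1 (U ∷ D ∷ [])
  cover : ∀ j {h T} → Skeleton h T → Skeleton (suc h) (wrap (T ++ UDs j))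

data DUDword : Path → Set where
  dnil : DUDword []
  dD   : ∀ {w} → DUDword w → DUDword (D ∷ w)
  dUD  : ∀ {w} → DUDword w → DUDword (U ∷ D ∷ w)

DUDword-++ : ∀ {a b} → DUDword a → DUDword b → DUDword (a ++ b)
DUDword-++ dnil     db = db
DUDword-++ (dD da)  db = dD (DUDword-++ da db)
DUDword-++ (dUD da) db = dUD (DUDword-++ da db)

DUDword-UDs : ∀ j → DUDword (UDs j)
DUDword-UDs zero    = dnil
DUDword-UDs (suc j) = dUD (DUDword-UDs j)

DUDword-UDs-D : ∀ j → DUDword (UDs j ++ [ D ])
DUDword-UDs-D j = DUDword-++ (DUDword-UDs j) (dD dnil)

-- The side condition pos = top when S = UD.
Admissible : ℕ → Pos → Set
Admissible h pos = pos ≡ top ⊎ 2 ≤ h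

Skeleton⇒Dyck : ∀ {h S} → Skeleton h S → Dyck S
Skeleton⇒Dyck peak        = Dyck-wrap nil
Skeleton⇒Dyck (cover j s) = Dyck-wrap (Dyck-++ (Skeleton⇒Dyck s) (Dyck-UDs j))

Skeleton-interior : ∀ {h S} → Skeleton h S → Σ[ Z ∈ Path ] (S ≡ wrap Z × Dyck Z)
Skeleton-interior peak        = [] , refl , nil
Skeleton-interior (cover j s) = _ , refl , Dyck-++ (Skeleton⇒Dyck s) (Dyck-UDs j)

Skeleton-nonempty : ∀ {h S} → Skeleton h S → S ≢ []
Skeleton-nonempty peak        ()
Skeleton-nonempty (cover j s) ()

Skeleton-height-pos : ∀ {h S} → Skeleton h S → 1 ≤ h
Skeleton-height-pos peak        = s≤s z≤n
Skeleton-height-pos (cover j s) = s≤s z≤n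

Skeleton-height : ∀ {h S} → Skeleton h S → height S ≡ h
Skeleton-height peak                 = refl
Skeleton-height (cover j {suc h} s) = trans (height-wrap (Dyck-++ (Skeleton⇒Dyck s) (Dyck-UDs j)))
  (cong suc (trans (height-++ (UDs j) (Skeleton⇒Dyck s))
                   (trans (cong (_⊔ height (UDs j)) (Skeleton-height s))
                          (m≥n⇒m⊔n≡m (≤-trans (height-UDs j) (s≤s z≤n))))))

Skeleton-lift : ∀ m {h X} → Skeleton h X → Skeleton (m + h) (lift m X)
Skeleton-lift zero    {X = X} s = subst (Skeleton _) (sym (++-identityʳ X)) s
Skeleton-lift (suc m) {X = X} s =
  subst (Skeleton _) (trans (cong wrap (++-identityʳ (lift m X))) (sym (lift-suc m X))) (cover 0 (Skeleton-lift m s))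

Skeleton-form : ∀ {h S} → Skeleton h S →
                Σ[ k ∈ ℕ ] Σ[ R ∈ Path ] (S ≡ Us (suc k) ++ D ∷ R × DUDword R × (2 ≤ h → 1 ≤ k))
Skeleton-form peak        = 0 , [] , refl , dnil , λ { (s≤s ()) }
Skeleton-form (cover j s) with Skeleton-form s
... | k , R , refl , dR , _ =
  suc k , R ++ UDs j ++ [ D ] ,
  cong (U ∷_) (solve 4 (λ a r x d → ((a ⊕ r) ⊕ x) ⊕ d ⊜ a ⊕ r ⊕ x ⊕ d) refl (Us (suc k)) (D ∷ R) (UDs j) [ D ]) ,
  DUDword-++ dR (DUDword-UDs-D j) , λ _ → s≤s z≤n

insert′ : Pos → ℕ → Path → Path → Path
insert′ top k R B = Us (suc k) ++ B ++ D ∷ R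
insert′ bot k R B = Us k ++ B ++ U ∷ D ∷ R

peakIdx-Us : ∀ k R → peakIdx (Us (suc k) ++ D ∷ R) ≡ k
peakIdx-Us zero          R = refl
peakIdx-Us (suc zero)    R = refl
peakIdx-Us (suc (suc k)) R = cong suc (peakIdx-Us (suc k) R)

insert-form : ∀ pos k R B → insert pos (Us (suc k) ++ D ∷ R) B ≡ insert′ pos k R B
insert-form top k R B rewrite peakIdx-Us k R | take-Us-++ k (D ∷ R) | drop-Us-++ k (D ∷ R) = refl
insert-form bot k R B rewrite peakIdx-Us k R | Us-suc-++ k (D ∷ R)
                            | take-Us-++ k (U ∷ D ∷ R) | drop-Us-++ k (U ∷ D ∷ R) = refl

insert′-Us-++ : ∀ pos m k R X B → insert′ pos (m + k) (R ++ X) B ≡ Us m ++ insert′ pos k R B ++ X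
insert′-Us-++ top (suc m) k R X B = cong (U ∷_) (insert′-Us-++ top m k R X B)
insert′-Us-++ bot (suc m) k R X B = cong (U ∷_) (insert′-Us-++ bot m k R X B)
insert′-Us-++ top zero    k R X B =
  cong (Us (suc k) ++_) (sym (++-assoc B (D ∷ R) X)) ⟨ trans ⟩ sym (++-assoc (Us (suc k)) (B ++ D ∷ R) X)
insert′-Us-++ bot zero    k R X B =
  cong (Us k ++_) (sym (++-assoc B (U ∷ D ∷ R) X)) ⟨ trans ⟩ sym (++-assoc (Us k) (B ++ U ∷ D ∷ R) X)

insert-Skeleton-++ : ∀ pos m {h T} X B → Skeleton h T →
                     insert pos (Us m ++ T ++ X) B ≡ Us m ++ insert pos T B ++ X
insert-Skeleton-++ pos m X B s with Skeleton-form s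
... | k , R , refl , _ , _ = begin
  insert pos (Us m ++ (Us (suc k) ++ D ∷ R) ++ X) B ≡⟨ cong (λ z → insert pos z B) T++X ⟩
  insert pos (Us (suc (m + k)) ++ D ∷ R ++ X) B    ≡⟨ insert-form pos (m + k) (R ++ X) B ⟩
  insert′ pos (m + k) (R ++ X) B                   ≡⟨ insert′-Us-++ pos m k R X B ⟩
  Us m ++ insert′ pos k R B ++ X                   ≡⟨ cong (λ z → Us m ++ z ++ X) (sym (insert-form pos k R B)) ⟩
  Us m ++ insert pos (Us (suc k) ++ D ∷ R) B ++ X  ∎
  where
  open ≡-Reasoning
  T++X : Us m ++ (Us (suc k) ++ D ∷ R) ++ X ≡ Us (suc (m + k)) ++ D ∷ R ++ X
  T++X = trans (cong (Us m ++_) (++-assoc (Us (suc k)) (D ∷ R) X))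
               (trans (Us-+-++ m (suc k) (D ∷ R ++ X)) (cong (λ n → Us n ++ D ∷ R ++ X) (+-suc m k)))

insert-Skeleton-lift : ∀ pos m {h T} B → Skeleton h T → insert pos (lift m T) B ≡ lift m (insert pos T B)
insert-Skeleton-lift pos m B = insert-Skeleton-++ pos m (Ds m) B

insert-wrap-++ : ∀ pos {h T} X B → Skeleton h T → insert pos (wrap (T ++ X)) B ≡ wrap (insert pos T B ++ X)
insert-wrap-++ pos {T = T} X B s = begin
  insert pos (wrap (T ++ X)) B          ≡⟨ cong (λ z → insert pos (U ∷ z) B) (++-assoc T X [ D ]) ⟩
  insert pos (Us 1 ++ T ++ X ++ [ D ]) B ≡⟨ insert-Skeleton-++ pos 1 (X ++ [ D ]) B s ⟩
  U ∷ insert pos T B ++ X ++ [ D ]       ≡⟨ cong (U ∷_) (sym (++-assoc (insert pos T B) X [ D ])) ⟩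
  wrap (insert pos T B ++ X)            ∎
  where open ≡-Reasoning

insert-Dyck : ∀ pos {S B} → Dyck S → Dyck B → Dyck (insert pos S B)
insert-Dyck top {S} = Dyck-insert-at (suc (peakIdx S))
insert-Dyck bot {S} = Dyck-insert-at (peakIdx S)

insert-nonempty : ∀ pos S {B} → B ≢ [] → insert pos S B ≢ []
insert-nonempty top S B≢[] eq = B≢[] (++-conicalˡ _ _ (++-conicalʳ (take (suc (peakIdx S)) S) _ eq))
insert-nonempty bot S B≢[] eq = B≢[] (++-conicalˡ _ _ (++-conicalʳ (take (peakIdx S) S) _ eq))

wrap-insert : ∀ A C Z B → A ++ C ≡ Z ++ [ D ] → C ≢ [] → Dyck Z → Dyck B →
              Σ[ Z′ ∈ Path ] (U ∷ A ++ B ++ C ≡ wrap Z′ × Dyck Z′)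
wrap-insert A C Z B A++C≡ C≢[] dZ dB with ++-∷ʳ-split A C Z D A++C≡ C≢[]
... | C′ , refl , A++C′≡Z =
  A ++ B ++ C′ ,
  cong (U ∷_) (solve 4 (λ a b c d → a ⊕ b ⊕ c ⊕ d ⊜ (a ⊕ b ⊕ c) ⊕ d) refl A B C′ [ D ]) ,
  Dyck-insert A B C′ (subst Dyck (sym A++C′≡Z) dZ) dB

insert-Primitive : ∀ pos {h S B} → Skeleton h S → Body B → Admissible h pos →
                   Σ[ Z ∈ Path ] (insert pos S B ≡ wrap Z × Dyck Z)
insert-Primitive pos {B = B} s bq adm with Skeleton-interior s | Skeleton-form s
... | Z , S≡ , dZ | k , R , refl , _ , 2≤h⇒1≤k = go pos adm
  where
  go : ∀ pos → Admissible _ pos → Σ[ Z′ ∈ Path ] (insert pos (Us (suc k) ++ D ∷ R) B ≡ wrap Z′ × Dyck Z′)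
  go top _ with wrap-insert (Us k) (D ∷ R) Z B (∷-injectiveʳ S≡) (λ ()) dZ (Body⇒Dyck bq)
  ... | Z′ , eq , dZ′ = Z′ , trans (insert-form top k R B) eq , dZ′
  go bot (inj₂ 2≤h) with 2≤h⇒1≤k 2≤h
  ... | s≤s {n = k′} _
    with wrap-insert (Us k′) (U ∷ D ∷ R) Z B (trans (sym (Us-suc-++ k′ (D ∷ R))) (∷-injectiveʳ S≡)) (λ ()) dZ (Body⇒Dyck bq)
  ... | Z′ , eq , dZ′ = Z′ , trans (insert-form bot (suc k′) R B) eq , dZ′

mutual
  F-Skeleton : ∀ {h S} → Skeleton h S → Σ[ h′ ∈ ℕ ] Skeleton h′ (F S)
  F-Skeleton peak        = 1 , peak
  F-Skeleton (cover j s) with F-cover-Skeleton j s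
  ... | h′ , s′ , _ = h′ , s′

  F-cover-Skeleton : ∀ j {h T} → Skeleton h T → Σ[ h′ ∈ ℕ ] (Skeleton h′ (F (wrap (T ++ UDs j))) × 2 ≤ h′)
  F-cover-Skeleton j s with F-wrap-Skeleton s
  ... | h′ , s′ , 2≤h′ = j + h′ , subst (Skeleton _) (sym (F-wrap-++-UDs j (Skeleton⇒Dyck s))) (Skeleton-lift j s′) ,
                         ≤-trans 2≤h′ (m≤n+m h′ j)

  F-wrap-Skeleton : ∀ {h T} → Skeleton h T → Σ[ h′ ∈ ℕ ] (Skeleton h′ (F (wrap T)) × 2 ≤ h′)
  F-wrap-Skeleton peak        = 2 , cover 0 peak , ≤-refl
  F-wrap-Skeleton (cover j s) with F-Skeleton s
  ... | h′ , s′ = suc h′ , subst (Skeleton _) (sym (F-wrap-wrap-++-UDs j (Skeleton⇒Dyck s) (Skeleton-nonempty s)))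
                                   (cover (suc j) s′) ,
                  s≤s (Skeleton-height-pos s′)

-- Induction along the skeleton: F-insert for U T (UD)^j D reduces, via F-wrap-++-UDs,
-- to F-insert-wrap for U T D, which in turn reduces to F-insert for the interior of T.
mutual
  F-insert : ∀ pos {h S B} → Skeleton h S → Body B → F (insert pos S B) ≡ insert (parityPos h pos) (F S) (F B)
  F-insert top {B = B} peak bq = trans (cong (λ z → F (wrap z)) (sym (++-identityʳ B))) (F-wrap-body-UDs 0 bq)
  F-insert bot         peak bq = F-++-UDs 1 (Body⇒Dyck bq)
  F-insert pos {B = B} (cover j {h} {T} s) bq = begin
    F (insert pos (wrap (T ++ UDs j)) B)  ≡⟨ cong F (insert-wrap-++ pos (UDs j) B s) ⟩
    F (wrap (insert pos T B ++ UDs j))    ≡⟨ F-wrap-++-UDs j (insert-Dyck pos (Skeleton⇒Dyck s) (Body⇒Dyck bq)) ⟩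
    lift j (F (wrap (insert pos T B)))    ≡⟨ cong (lift j) (F-insert-wrap pos s bq) ⟩
    lift j (insert p (F (wrap T)) (F B))  ≡⟨ sym (insert-Skeleton-lift p j (F B) (proj₁ (proj₂ (F-wrap-Skeleton s)))) ⟩
    insert p (lift j (F (wrap T))) (F B)  ≡⟨ cong (λ z → insert p z (F B)) (sym (F-wrap-++-UDs j (Skeleton⇒Dyck s))) ⟩
    insert p (F (wrap (T ++ UDs j))) (F B) ∎
    where
    open ≡-Reasoning
    p = parityPos (suc h) pos

  F-insert-wrap : ∀ pos {h T B} → Skeleton h T → Body B →
                  F (wrap (insert pos T B)) ≡ insert (parityPos (suc h) pos) (F (wrap T)) (F B)
  F-insert-wrap top {B = B} peak bq =
    trans (F-wrap-wrap (Body⇒Dyck bq) (Body-nonempty bq)) (cong (U ∷_) (++-assoc (F B) (U ∷ D ∷ []) [ D ]))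
  F-insert-wrap bot peak bq = F-wrap-body-UDs 1 bq
  F-insert-wrap pos {B = B} (cover j {h} {T} s) bq = begin
    F (wrap (insert pos (wrap (T ++ UDs j)) B))   ≡⟨ cong (λ z → F (wrap z)) (insert-wrap-++ pos (UDs j) B s) ⟩
    F (wrap (wrap (insert pos T B ++ UDs j)))     ≡⟨ F-wrap-wrap-++-UDs j (insert-Dyck pos dT (Body⇒Dyck bq))
                                                                         (insert-nonempty pos T (Body-nonempty bq)) ⟩
    wrap (F (insert pos T B) ++ UDs (suc j))      ≡⟨ cong (λ z → wrap (z ++ UDs (suc j))) (F-insert pos s bq) ⟩
    wrap (insert p (F T) (F B) ++ UDs (suc j))    ≡⟨ sym (insert-wrap-++ p (UDs (suc j)) (F B) (proj₂ (F-Skeleton s))) ⟩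
    insert p (wrap (F T ++ UDs (suc j))) (F B)    ≡⟨ cong (λ z → insert p z (F B))
                                                          (sym (F-wrap-wrap-++-UDs j dT (Skeleton-nonempty s))) ⟩
    insert p (F (wrap (wrap (T ++ UDs j)))) (F B) ∎
    where
    open ≡-Reasoning
    p = parityPos h pos
    dT = Skeleton⇒Dyck s

F-Skeleton-Admissible : ∀ pos {h S} → Skeleton h S → Admissible h pos →
                        Σ[ h′ ∈ ℕ ] (Skeleton h′ (F S) × Admissible h′ (parityPos h pos))
F-Skeleton-Admissible top peak        _ = 1 , peak , inj₁ refl
F-Skeleton-Admissible bot peak        (inj₂ (s≤s ()))
F-Skeleton-Admissible pos (cover j s) _ with F-cover-Skeleton j s
... | h′ , s′ , 2≤h′ = h′ , s′ , inj₂ 2≤h′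

DUDword-noDUU : ∀ {T} → DUDword T → ∀ j → ¬ DUUat T j
DUDword-noDUU (dD d)         (suc j)       x       = DUDword-noDUU d j x
DUDword-noDUU (dUD d)        (suc (suc j)) x       = DUDword-noDUU d j x
DUDword-noDUU dnil           zero          (_ , ())
DUDword-noDUU (dD dnil)      zero          (_ , ())
DUDword-noDUU (dD (dD _))    zero          (_ , ())
DUDword-noDUU (dD (dUD _))   zero          (_ , ())
DUDword-noDUU (dUD _)        zero          (_ , ())
DUDword-noDUU (dUD dnil)     (suc zero)    (_ , ())
DUDword-noDUU (dUD (dD _))   (suc zero)    (_ , ())
DUDword-noDUU (dUD (dUD _))  (suc zero)    (_ , ())

DUUat-Us-++ : ∀ n r j → DUUat (Us n ++ r) j → Σ[ j′ ∈ ℕ ] (j ≡ n + j′ × DUUat r j′)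
DUUat-Us-++ zero    r j       duu = j , refl , duu
DUUat-Us-++ (suc n) r (suc j) duu with DUUat-Us-++ n r j duu
... | j′ , refl , duu′ = j′ , refl , duu′

DUUat-++-DUDword : ∀ A T j → DUDword T → DUUat (A ++ T) j → j < length A
DUUat-++-DUDword []      T j       dT duu = ⊥-elim (DUDword-noDUU dT j duu)
DUUat-++-DUDword (a ∷ A) T zero    dT duu = s≤s z≤n
DUUat-++-DUDword (a ∷ A) T (suc j) dT duu = s≤s (DUUat-++-DUDword A T j dT duu)

DUUat-++-D-DUDword : ∀ A T j → DUDword T → DUUat (A ++ D ∷ T) j → DUUat (A ++ [ D ]) j
DUUat-++-D-DUDword []      T       (suc j) dT duu = ⊥-elim (DUDword-noDUU dT j duu)
DUUat-++-D-DUDword (a ∷ A) T       (suc j) dT duu = DUUat-++-D-DUDword A T j dT duu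
DUUat-++-D-DUDword []      (U ∷ T) zero    () (_ , refl)
DUUat-++-D-DUDword (D ∷ U ∷ U ∷ A) T zero  dT (_ , refl) = A ++ [ D ] , refl

-- Inserting a body X Y (Y its last component, X ending with D) into a skeleton
-- U^n W: the DUU at the junction of X and Y is the rightmost one of minimal height n.
module InsertedBody (n : ℕ) (X₀ t W : Path) (dX : Dyck (X₀ ++ [ D ])) (dt : Dyck (U ∷ t)) (dW : DUDword W)
  where
  X Y B P pre : Path
  X   = X₀ ++ [ D ]
  Y   = wrap (U ∷ t)
  B   = X ++ Y
  P   = Us n ++ B ++ W
  pre = Us n ++ X

  i m : ℕ
  i = n + length X₀
  m = i + length Y

  dY : Dyck Y
  dY = Dyck-wrap dt

  dB : Dyck B
  dB = Dyck-++ dX dY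

  Y-noDyckPrefix : ∀ k → 0 < k → k < length Y → ¬ IsDyck (take k Y)
  Y-noDyckPrefix = proj₂ (proj₂ (wrap-Primitive dt))

  length-X : length X ≡ suc (length X₀)
  length-X = trans (length-++ X₀) (+-comm (length X₀) 1)

  length-pre : length pre ≡ suc i
  length-pre = trans (length-++ (Us n)) (trans (cong₂ _+_ (length-replicate n) length-X) (+-suc n (length X₀)))

  P≡pre++ : P ≡ pre ++ Y ++ W
  P≡pre++ = solve 4 (λ a x y w → a ⊕ (x ⊕ y) ⊕ w ⊜ (a ⊕ x) ⊕ y ⊕ w) refl (Us n) X Y W

  take-pre : ∀ k → take (suc i + k) P ≡ pre ++ take k (Y ++ W)
  take-pre k = trans (cong (λ z → take (z + k) P) (sym length-pre))
                     (trans (cong (take (length pre + k)) P≡pre++) (take-++ʳ k pre (Y ++ W)))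

  drop-pre : ∀ w → drop (suc i) (pre ++ w) ≡ w
  drop-pre w = trans (cong (λ z → drop z (pre ++ w)) (sym length-pre)) (drop-length-++ pre w)

  slice-pre : ∀ k → slice P (suc i) (i + k) ≡ take k (Y ++ W)
  slice-pre k = trans (cong (drop (suc i)) (take-pre k)) (drop-pre (take k (Y ++ W)))

  DUU-i : DUUat P i
  DUU-i = (t ++ [ D ]) ++ W , (begin
    drop i P                                          ≡⟨ cong (drop i) P≡ ⟩
    drop i ((Us n ++ X₀) ++ D ∷ Y ++ W)               ≡⟨ cong (λ z → drop z ((Us n ++ X₀) ++ D ∷ Y ++ W)) (sym length-UsX₀) ⟩
    drop (length (Us n ++ X₀)) ((Us n ++ X₀) ++ D ∷ Y ++ W) ≡⟨ drop-length-++ (Us n ++ X₀) (D ∷ Y ++ W) ⟩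
    D ∷ Y ++ W                                        ∎)
    where
    open ≡-Reasoning
    P≡ : P ≡ (Us n ++ X₀) ++ D ∷ Y ++ W
    P≡ = solve 5 (λ a x d y w → a ⊕ ((x ⊕ d) ⊕ y) ⊕ w ⊜ (a ⊕ x) ⊕ d ⊕ y ⊕ w) refl (Us n) X₀ [ D ] Y W
    length-UsX₀ : length (Us n ++ X₀) ≡ i
    length-UsX₀ = trans (length-++ (Us n)) (cong (_+ length X₀) (length-replicate n))

  occHeight-i : occHeight P i ≡ n
  occHeight-i = trans (cong level take-i)
    (walk⇒level pre (trans (walk-Us-++ n 0 X) (trans (Dyck⇒walk dX (n + 0)) (cong just (+-identityʳ n)))))
    where
    take-i : take (suc i) P ≡ pre
    take-i = trans (cong (λ z → take z P) (sym length-pre))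
                   (trans (cong (take (length pre)) P≡pre++) (take-length-++ pre (Y ++ W)))

  -- Every occurrence of DUU lies inside B, since B ends with DD and W is a DUD-word.
  occurrence-in-B : ∀ j → DUUat P j →
    Σ[ j′ ∈ ℕ ] Σ[ l ∈ ℕ ] (j ≡ n + j′ × suc (suc j′) < length B ×
                            walk 0 (take (suc j′) B) ≡ just l × occHeight P j ≡ n + l)
  occurrence-in-B j duu with DUUat-Us-++ n (B ++ W) j duu | wrap-EndsDD dt (λ ())
  ... | j′ , refl , duu′ | inj₂ (Y₀ , Y≡) = j′ , l , refl , j′+2<B , walk-l , occ
    where
    B≡ : B ≡ (X ++ Y₀) ++ D ∷ D ∷ []
    B≡ = trans (cong (X ++_) Y≡) (sym (++-assoc X Y₀ (D ∷ D ∷ [])))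
    j′<B₀ : j′ < length (X ++ Y₀)
    j′<B₀ = DUUat-++-DUDword (X ++ Y₀) (D ∷ D ∷ W) j′ (dD (dD dW))
              (subst (λ z → DUUat z j′) (trans (cong (_++ W) B≡) (++-assoc (X ++ Y₀) (D ∷ D ∷ []) W)) duu′)
    j′+2<B : suc (suc j′) < length B
    j′+2<B = subst (suc (suc j′) <_) (sym (trans (cong length B≡) (length-++ (X ++ Y₀))))
               (subst (_< length (X ++ Y₀) + 2) (+-comm j′ 2) (+-monoˡ-< 2 j′<B₀))
    l : ℕ
    l = proj₁ (walk-take (suc j′) 0 B (Dyck⇒walk dB 0))
    walk-l : walk 0 (take (suc j′) B) ≡ just l
    walk-l = proj₂ (walk-take (suc j′) 0 B (Dyck⇒walk dB 0))
    take-j : take (suc (n + j′)) P ≡ Us n ++ take (suc j′) B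
    take-j = trans (cong (λ z → take z P) (sym (+-suc n j′)))
               (trans (take-Us-+ n (suc j′) (B ++ W))
                      (cong (Us n ++_) (take-++ˡ (suc j′) B W (<⇒≤ (<-trans (n<1+n (suc j′)) j′+2<B)))))
    occ : occHeight P (n + j′) ≡ n + l
    occ = trans (cong level take-j)
            (walk⇒level (Us n ++ take (suc j′) B)
              (trans (walk-Us-++ n 0 (take (suc j′) B)) (walk-shift n 0 (take (suc j′) B) walk-l)))

  minimal : ∀ j → DUUat P j → occHeight P i ≤ occHeight P j
  minimal j duu with occurrence-in-B j duu
  ... | _ , l , _ , _ , _ , occ = subst₂ _≤_ (sym occHeight-i) (sym occ) (m≤m+n n l)

  -- An occurrence at level n further right would end a proper Dyck prefix of Y.
  rightmost : ∀ j → DUUat P j → occHeight P j ≡ occHeight P i → j ≤ i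
  rightmost j duu same with occurrence-in-B j duu
  ... | j′ , l , refl , j′+2<B , walk-l , occ with j′ ≤? length X₀
  ...   | yes j′≤ = +-monoʳ-≤ n j′≤
  ...   | no  j′≰ = ⊥-elim (Y-noDyckPrefix (suc d) (s≤s z≤n) d+1<Y Dyck-prefix)
    where
    l≡0 : l ≡ 0
    l≡0 = +-cancelˡ-≡ n l 0 (trans (sym occ) (trans same (trans occHeight-i (sym (+-identityʳ n)))))
    X≤j′ : length X ≤ j′
    X≤j′ = subst (_≤ j′) (sym length-X) (≰⇒> j′≰)
    d : ℕ
    d = proj₁ (m≤n⇒∃[o]m+o≡n X≤j′)
    X+d≡j′ : length X + d ≡ j′
    X+d≡j′ = proj₂ (m≤n⇒∃[o]m+o≡n X≤j′)
    take-B : take (suc j′) B ≡ X ++ take (suc d) Y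
    take-B = trans (cong (λ z → take (suc z) B) (sym X+d≡j′))
               (trans (cong (λ z → take z B) (sym (+-suc (length X) d))) (take-++ʳ (suc d) X Y))
    Dyck-prefix : IsDyck (take (suc d) Y)
    Dyck-prefix = trans (sym (walk-++ 0 X (take (suc d) Y) (Dyck⇒walk dX 0)))
                    (trans (cong (walk 0) (sym take-B)) (trans walk-l (cong just l≡0)))
    d+1<Y : suc d < length Y
    d+1<Y = <-trans (n<1+n (suc d)) (+-cancelˡ-< (length X) (suc (suc d)) (length Y)
              (subst₂ _<_ (trans (cong (λ z → suc (suc z)) (sym X+d≡j′))
                                 (sym (trans (+-suc (length X) (suc d)) (cong suc (+-suc (length X) d)))))
                          (length-++ X) j′+2<B))

  match : Match P (suc i) m
  match = Y++W≢[] , i<m , m<P , Dyck-Y , shortest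
    where
    Y++W≢[] : drop (suc i) P ≢ []
    Y++W≢[] eq = case trans (sym (trans (cong (drop (suc i)) P≡pre++) (drop-pre (Y ++ W)))) eq of λ ()
    i<m : suc i ≤ m
    i<m = subst (suc i ≤_) (sym (+-suc i (suc (length (t ++ [ D ]))))) (s≤s (m≤m+n i _))
    m<P : m < length P
    m<P = subst (m <_) (sym (trans (cong length P≡pre++) (trans (length-++ pre) (cong (_+ length (Y ++ W)) length-pre))))
            (subst (λ z → m < suc i + z) (sym (length-++ Y)) (s≤s (+-monoʳ-≤ i (m≤m+n (length Y) (length W)))))
    Dyck-Y : IsDyck (slice P (suc i) m)
    Dyck-Y = subst IsDyck (sym (trans (slice-pre (length Y)) (take-length-++ Y W))) (Dyck⇒IsDyck dY)
    shortest : ∀ m′ → suc i ≤ m′ → m′ < m → ¬ IsDyck (slice P (suc i) m′)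
    shortest m′ i<m′ m′<m with m≤n⇒∃[o]m+o≡n i<m′
    ... | d , refl = Y-noDyckPrefix (suc d) (s≤s z≤n) d+1<Y ∘ subst IsDyck slice≡
      where
      d+1<Y : suc d < length Y
      d+1<Y = +-cancelˡ-< i (suc d) (length Y) (subst (_< m) (sym (+-suc i d)) m′<m)
      slice≡ : slice P (suc i) (suc i + d) ≡ take (suc d) Y
      slice≡ = trans (cong (slice P (suc i)) (sym (+-suc i d)))
                 (trans (slice-pre (suc d)) (take-++ˡ (suc d) Y W (<⇒≤ d+1<Y)))

  suc-m : suc m ≡ n + length B
  suc-m = begin
    suc (n + length X₀ + length Y)    ≡⟨ cong suc (+-assoc n (length X₀) (length Y)) ⟩
    suc (n + (length X₀ + length Y))  ≡⟨ sym (+-suc n _) ⟩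
    n + (suc (length X₀) + length Y)  ≡⟨ cong (λ z → n + (z + length Y)) (sym length-X) ⟩
    n + (length X + length Y)         ≡⟨ cong (n +_) (sym (length-++ X)) ⟩
    n + length B                      ∎
    where open ≡-Reasoning

  body-slice : B ≡ slice P (occHeight P i) m
  body-slice = sym (begin
    slice P (occHeight P i) m          ≡⟨ cong (λ z → slice P z m) occHeight-i ⟩
    drop n (take (suc m) P)            ≡⟨ cong (λ z → drop n (take z P)) suc-m ⟩
    drop n (take (n + length B) P)     ≡⟨ cong (drop n) (take-Us-+ n (length B) (B ++ W)) ⟩
    drop n (Us n ++ take (length B) (B ++ W)) ≡⟨ cong (λ z → drop n (Us n ++ z)) (take-length-++ B W) ⟩
    drop n (Us n ++ B)                 ≡⟨ drop-Us-++ n B ⟩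
    B                                  ∎)
    where open ≡-Reasoning

  skeleton-slices : Us n ++ W ≡ take (occHeight P i) P ++ drop (suc m) P
  skeleton-slices = sym (trans (cong (λ z → take z P ++ drop (suc m) P) occHeight-i)
    (cong₂ _++_ (take-Us-++ n (B ++ W))
                (trans (cong (λ z → drop z P) suc-m) (trans (drop-Us-+ n (length B) (B ++ W)) (drop-length-++ B W)))))

  skelBody : ContainsDUU P × SkelBody P (Us n ++ W) B
  skelBody = (i , DUU-i) , i , m , DUU-i , minimal , rightmost , match , body-slice , skeleton-slices

SkelBody-cong : ∀ {P P′ S S′ B B′} → P ≡ P′ → S ≡ S′ → B ≡ B′ →
                ContainsDUU P′ × SkelBody P′ S′ B′ → ContainsDUU P × SkelBody P S B
SkelBody-cong refl refl refl sb = sb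

insert-SkelBody : ∀ pos {h S B} → Skeleton h S → Body B → Admissible h pos →
                  ContainsDUU (insert pos S B) × SkelBody (insert pos S B) S B
insert-SkelBody pos s (body _ _ nil z≢[]) _ = ⊥-elim (z≢[] refl)
insert-SkelBody pos {B = B} s (body {x} {y} dx dy (node {a} {b} da db) _) adm
  with Dyck-∷ʳD (node dx dy) (λ ()) | Skeleton-form s
... | X₀ , X≡ | k , R , refl , dR , 2≤h⇒1≤k = go pos adm
  where
  t = a ++ D ∷ b
  B≡ : B ≡ (X₀ ++ [ D ]) ++ wrap (U ∷ t)
  B≡ = cong (_++ wrap (U ∷ t)) X≡
  dX : Dyck (X₀ ++ [ D ])
  dX = subst Dyck X≡ (node dx dy)
  go : ∀ pos → Admissible _ pos →
       ContainsDUU (insert pos (Us (suc k) ++ D ∷ R) B) × SkelBody (insert pos (Us (suc k) ++ D ∷ R) B) (Us (suc k) ++ D ∷ R) B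
  go top _ =
    SkelBody-cong (trans (insert-form top k R B) (cong (λ z → Us (suc k) ++ z ++ D ∷ R) B≡)) refl B≡
      (InsertedBody.skelBody (suc k) X₀ t (D ∷ R) dX (node da db) (dD dR))
  go bot (inj₂ 2≤h) with 2≤h⇒1≤k 2≤h
  ... | s≤s {n = k′} _ =
    SkelBody-cong (trans (insert-form bot (suc k′) R B) (cong (λ z → Us (suc k′) ++ z ++ U ∷ D ∷ R) B≡))
                  (Us-suc-++ (suc k′) (D ∷ R)) B≡
      (InsertedBody.skelBody (suc k′) X₀ t (U ∷ D ∷ R) dX (node da db) (dUD dR))

insert-decomposition : ∀ pos {h S B} → Skeleton h S → Body B → Admissible h pos →
                       Primitive (insert pos S B) × ContainsDUU (insert pos S B) × SkelBody (insert pos S B) S B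
insert-decomposition pos s bq adm with insert-Primitive pos s bq adm
... | Z , P≡ , dZ = subst Primitive (sym P≡) (wrap-Primitive dZ) , insert-SkelBody pos s bq adm

wrap-DUDword-noDUU : ∀ {W} → DUDword (W ++ [ D ]) → ∀ i → ¬ DUUat (wrap W) i
wrap-DUDword-noDUU dW zero    (_ , ())
wrap-DUDword-noDUU dW (suc i) = DUDword-noDUU dW i

data Decomposition (P : Path) : Set where
  decomposition : ∀ pos {h S B} → Skeleton h S → Body B → Admissible h pos → P ≡ insert pos S B → Decomposition P

decompose-≤ : ∀ n P → length P ≤ n → Primitive P → ContainsDUU P → Decomposition P
decompose-≤ n P P≤n prim (i , duu) with Primitive⇒wrap prim
... | a , da , refl with shape da
...   | shape-UDs j = ⊥-elim (wrap-DUDword-noDUU (DUDword-UDs-D j) i duu)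
...   | shape-body zero {q} bq =
  decomposition top peak bq (inj₁ refl) (cong wrap (++-identityʳ q))
...   | shape-body (suc j) {q} bq =
  decomposition bot (cover j peak) bq (inj₂ ≤-refl) (cong (U ∷_) (++-assoc q (UDs (suc j)) [ D ]))
...   | shape-wrap j {r} dr r≢[]
  with DUUat-++-D-DUDword (U ∷ U ∷ r) (UDs j ++ [ D ]) i (DUDword-UDs-D j) (subst (λ z → DUUat z i) P≡ duu)
  where
  P≡ : wrap (wrap r ++ UDs j) ≡ (U ∷ U ∷ r) ++ D ∷ UDs j ++ [ D ]
  P≡ = cong (U ∷_) (solve 4 (λ u r d x → ((u ⊕ r ⊕ d) ⊕ x) ⊕ d ⊜ (u ⊕ r) ⊕ d ⊕ x ⊕ d) refl [ U ] r [ D ] (UDs j))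
... | duu′ with i | n | P≤n
... | suc i′ | suc n′ | s≤s P≤n′
  with decompose-≤ n′ (wrap r) (≤-trans (length-≤-++-++ (wrap r) (UDs j) [ D ]) P≤n′) (wrap-Primitive dr) (i′ , duu′)
... | decomposition pos {B = B} s bq adm r≡ =
  decomposition pos (cover j s) bq (inj₂ (s≤s (Skeleton-height-pos s)))
    (trans (cong (λ z → wrap (z ++ UDs j)) r≡) (sym (insert-wrap-++ pos (UDs j) B s)))

decompose : ∀ {P} → Primitive P → ContainsDUU P → Decomposition P
decompose {P} = decompose-≤ (length P) P ≤-refl

Match-unique : ∀ {P k m m′} → Match P k m → Match P k m′ → m ≡ m′
Match-unique {m = m} {m′} (_ , k≤m , _ , dm , shortest) (_ , k≤m′ , _ , dm′ , shortest′) with <-cmp m m′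
... | tri< m<m′ _ _ = ⊥-elim (shortest′ m k≤m m<m′ dm)
... | tri≈ _ m≡m′ _ = m≡m′
... | tri> _ _ m′<m = ⊥-elim (shortest m′ k≤m′ m′<m dm′)

SkelBody-unique : ∀ {P S B S′ B′} → SkelBody P S B → SkelBody P S′ B′ → S ≡ S′ × B ≡ B′
SkelBody-unique {P} (i , m , di , mi , ri , ma , B≡ , S≡) (i′ , m′ , di′ , mi′ , ri′ , ma′ , B′≡ , S′≡)
  with ≤-antisym (ri i′ di′ (≤-antisym (mi′ i di) (mi i′ di′))) (ri′ i di (≤-antisym (mi i′ di′) (mi′ i di)))
... | refl with Match-unique {P} ma ma′
... | refl = trans S≡ (sym S′≡) , trans B≡ (sym B′≡)

-- In position bot the skeleton UD would leave B as a proper Dyck prefix.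
Primitive⇒Admissible : ∀ pos {h S B} → Skeleton h S → Body B → Primitive (insert pos S B) → Admissible h pos
Primitive⇒Admissible top         s           bq prim = inj₁ refl
Primitive⇒Admissible bot         (cover j s) bq prim = inj₂ (s≤s (Skeleton-height-pos s))
Primitive⇒Admissible bot {B = B} peak        bq (_ , _ , noPrefix) =
  ⊥-elim (noPrefix (length B) (0<B bq) B<B++UD B-prefix)
  where
  B-prefix : IsDyck (take (length B) (B ++ U ∷ D ∷ []))
  B-prefix = subst IsDyck (sym (take-length-++ B (U ∷ D ∷ []))) (Dyck⇒IsDyck (Body⇒Dyck bq))
  0<B : ∀ {B} → Body B → 0 < length B
  0<B (body _ _ _ _) = s≤s z≤n
  B<B++UD : length B < length (B ++ U ∷ D ∷ [])
  B<B++UD = subst (length B <_) (sym (length-++ B)) (m<m+n (length B) (s≤s z≤n))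

proposition8 : (P S B : Path) (pos : Pos) →
    Primitive P → ContainsDUU P →
    SkelBody P S B → HasPos P S B pos →
    Primitive (F P) × ContainsDUU (F P) ×
    SkelBody (F P) (F S) (F B) ×
    HasPos (F P) (F S) (F B) (parityPos (height S) pos)
proposition8 P S B pos prim duu sb refl with decompose prim duu
... | decomposition pos₀ {S = S₀} {B₀} s₀ bq₀ adm₀ P≡
  with SkelBody-unique sb (subst (λ Q → SkelBody Q S₀ B₀) (sym P≡) (proj₂ (proj₂ (insert-decomposition pos₀ s₀ bq₀ adm₀))))
... | refl , refl
  rewrite Skeleton-height s₀ | F-insert pos s₀ bq₀
  with F-Skeleton-Admissible pos s₀ (Primitive⇒Admissible pos s₀ bq₀ prim)
... | _ , s′ , adm′ with insert-decomposition _ s′ (F-Body bq₀) adm′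
... | prim′ , duu′ , sb′ = prim′ , duu′ , sb′ , refl
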